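{- Let $r$ be a positive integer. (i) For $k\ge l+\sum_{j=1}^r h_j$ and $l\ge h_1\ge\cdots\ge h_r\ge1$, $$\mathcal{D}_q G^t_{r-1}(k, l, h_1, \ldots, h_r; z) = \frac{1}{z} \left\{ G^t_{r-1}(k-1, l, h_1, \ldots, h_r; z) + G^t_{r-2}(k-1, l, h_1, \ldots, h_{r-1}, h_r-1; z) -G^t_{r-1}(k-1, l, h_1, \ldots, h_{r-1}, h_r-1; z)\right\}.$$ (ii) For $0\le j\le r-2$, $k\ge l+\sum_{i=1}^r h_i$, $l\ge h_1\ge\cdots\ge h_r\ge0$, $h_{j+1}\ge1$, \begin{align*} &\mathcal{D}_q \left\{ G^t_j(k, l, h_1, \ldots, h_r; z) - G^t_{j+1}(k, l, h_1, \ldots, h_r; z) \right\} \\ &= \frac{1}{z}\left\{ G^t_{j-1}(k-1, l, h_1, \ldots, h_j, h_{j+1}-1, h_{j+2}, \ldots, h_r; z) - G^t_{j}(k-1, l, h_1, \ldots, h_j, h_{j+1}-1, h_{j+2}, \ldots, h_r; z)\right\}. \end{align*} (iii) For $k\ge l+\sum_{i=1}^r h_i$, $l\ge h_1\ge\cdots\ge h_r\ge0$, $l\ge2$, $$\mathcal{D}_q \left\{ G^t(k, l, h_1, \ldots, h_r; z) - G^t_{0}(k, l, h_1, \ldots, h_r; z) \right\} = \left( \frac{t}{z} + \frac{1}{1-z} \right) G^t(k-1, l-1, h_1, \ldots, h_r; z).$$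
   Context: $q$ is a formal parameter, $[n]=(1-q^n)/(1-q)$. For an index $\mathbf k=(k_1,\dots,k_l)$ of positive integers, $Li_{\mathbf k;q}(z)=\sum_{m_1>\cdots>m_l\ge1}\frac{z^{m_1}}{[m_1]^{k_1}\cdots[m_l]^{k_l}}$ and $Li^t_{\mathbf k;q}(z)=\sum_{\mathbf p}Li_{\mathbf p;q}(z)t^{l-\mathrm{dep}(\mathbf p)}$, where $\mathbf p$ runs over indices $(k_1\,\square\cdots\square\,k_l)$ with each $\square$ filled by ``$,$'' or ``$+$''. The $i$-height of $\mathbf k$ is $\#\{j:k_j\ge i+1\}$. For integers $k,l,h_1,\dots,h_r\ge0$ and $-1\le j\le r-1$, $I_j(k,l,h_1,\dots,h_r)$ is the set of indices of weight $k$, depth $l$, $i$-height $h_i$ ($i=1,\dots,r$) with $k_1\ge j+2$; $G^t_j(k,l,h_1,\dots,h_r;z)=\sum_{\mathbf k\in I_j(k,l,h_1,\dots,h_r)}Li^t_{\mathbf k;q}(z)$ (an empty sum is $0$), $G^t=G^t_{ -1}$, with the convention $G^t(0,0,\dots,0;z)=1$. $(\mathcal D_q f)(z)=\frac{f(z)-f(qz)}{(1-q)z}$. -}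

module Defs where

open import Data.Nat as ℕ using (ℕ; zero; suc; _∸_; _≡ᵇ_; _<ᵇ_; _%_)
open import Data.Integer as ℤ using (ℤ; +_; -[1+_])
open import Data.Bool using (Bool; true; false; if_then_else_; _∧_)
open import Data.List as List using (List; []; _∷_; _++_; map; foldr; concatMap; applyUpTo; filterᵇ; length)
open import Data.Vec as Vec using (Vec)
open import Data.Product using (_×_; _,_)
open import Relation.Binary.PropositionalEquality using (_≡_)
open import Relation.Nullary.Decidable using (⌊_⌋)

-- Coefficient ring: ℤ[t][[q]], an element is its coefficient table
--   x c b = coefficient of t^c q^b.
-- (All quantities of the paper live here: 1/[m] = (1-q)/(1-q^m) is a
-- power series in q with integer coefficients.)

C : Set
C = ℕ → ℕ → ℤ

zeroC : C
zeroC _ _ = + 0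

oneC : C
oneC zero zero = + 1
oneC _    _    = + 0

_⊕_ : C → C → C
(x ⊕ y) c b = x c b ℤ.+ y c b

⊖_ : C → C
(⊖ x) c b = ℤ.- x c b

sumℤ : (ℕ → ℤ) → ℕ → ℤ
sumℤ f zero    = + 0
sumℤ f (suc n) = sumℤ f n ℤ.+ f n

_⊗_ : C → C → C
(x ⊗ y) c b =
  sumℤ (λ c₁ → sumℤ (λ b₁ → x c₁ b₁ ℤ.* y (c ∸ c₁) (b ∸ b₁)) (suc b)) (suc c)

powC : C → ℕ → C
powC x zero    = oneC
powC x (suc k) = x ⊗ powC x k

sumC : (ℕ → C) → ℕ → C
sumC f zero    = zeroC
sumC f (suc n) = sumC f n ⊕ f n

qint : ℕ → C
qint m zero    b = if b ℕ.<ᵇ m then + 1 else + 0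
qint m (suc c) b = + 0

geo : ℕ → ℕ → ℤ
geo n b = if (b % suc n) ≡ᵇ 0 then + 1 else + 0

-- invq n = 1/[n+1] = (1 - q) · Σ_j q^((n+1) j)
invq : ℕ → C
invq n zero zero    = geo n 0
invq n zero (suc b) = geo n (suc b) ℤ.- geo n b
invq n (suc c) b    = + 0

tpow : ℕ → C → C
tpow e x c b = if e ℕ.≤ᵇ c then x (c ∸ e) b else + 0

-- Formal power series in z with coefficients in C:  f N = coeff of z^N

Ser : Set
Ser = ℕ → C

_⊕ˢ_ : Ser → Ser → Ser
(f ⊕ˢ g) N = f N ⊕ g N

_⊖ˢ_ : Ser → Ser → Ser
(f ⊖ˢ g) N = f N ⊕ (⊖ g N)

_≋_ : Ser → Ser → Set
f ≋ g = ∀ N c b → f N c b ≡ g N c b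

-- z · (D_q f) :  D_q z^N = [N] z^(N-1), hence coefficient of z^N in
-- z·D_q f is [N] · f_N.
zDq : Ser → Ser
zDq f N = qint N ⊗ f N

tˢ : Ser → Ser
tˢ f N = tpow 1 (f N)

-- multiplication by z/(1-z) = z + z^2 + ...
zOver1-z : Ser → Ser
zOver1-z f N = sumC f N

sumSer : List Ser → Ser
sumSer = foldr _⊕ˢ_ (λ _ → zeroC)

-- q-multiple polylogarithms
--   Li_{k;q}(z) = Σ_{m₁>⋯>m_l≥1} z^{m₁} / ([m₁]^{k₁}⋯[m_l]^{k_l})
-- LiCoeff ks N = coefficient of z^N ; Li_∅ = 1.

LiCoeff : List ℕ → Ser
LiCoeff []       zero    = oneC
LiCoeff []       (suc N) = zeroC
LiCoeff (k ∷ ks) zero    = zeroC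
LiCoeff (k ∷ ks) (suc n) = powC (invq n) k ⊗ sumC (LiCoeff ks) (suc n)

Li : List ℕ → Ser
Li = LiCoeff

-- all indices (k₁ □ ⋯ □ k_l) with □ ∈ {",", "+"}, paired with the
-- number of "+" signs (= l - dep p)
mergeFrom : ℕ → List ℕ → List (List ℕ × ℕ)
mergeFrom a []       = ([ a ]′ , 0) ∷ []
  where [_]′ : ℕ → List ℕ
        [ x ]′ = x ∷ []
mergeFrom a (b ∷ bs) =
  map (λ { (p , e) → (a ∷ p , e) }) (mergeFrom b bs)
  ++ map (λ { (p , e) → (p , suc e) }) (mergeFrom (a ℕ.+ b) bs)

merges : List ℕ → List (List ℕ × ℕ)
merges []       = ([] , 0) ∷ []
merges (a ∷ as) = mergeFrom a as

-- Li^t_{k;q}(z) = Σ_p Li_{p;q}(z) t^{l - dep p}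
Lit : List ℕ → Ser
Lit ks = sumSer (map (λ { (p , e) → λ N → tpow e (Li p N) }) (merges ks))

weight : List ℕ → ℕ
weight = foldr ℕ._+_ 0

height : ℕ → List ℕ → ℕ
height i p = length (filterᵇ (λ a → i ℕ.<ᵇ a) p)

heightsFrom : {r : ℕ} → ℕ → Vec ℕ r → List ℕ → Bool
heightsFrom i Vec.[]       p = true
heightsFrom i (x Vec.∷ xs) p = (height i p ≡ᵇ x) ∧ heightsFrom (suc i) xs p

-- condition k₁ ≥ j+2 (j ∈ ℤ, j ≥ -1); for the empty index there is no
-- k₁, and only j = -1 is admitted (so that G^t(0,0,…,0;z) = 1)
firstOK : ℤ → List ℕ → Bool
firstOK j []      = ⌊ j ℤ.≤? -[1+ 0 ] ⌋
firstOK j (a ∷ _) = ⌊ (j ℤ.+ + 2) ℤ.≤? + a ⌋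

lists : ℕ → ℕ → List (List ℕ)
lists zero    k = [] ∷ []
lists (suc l) k = concatMap (λ a → map (a ∷_) (lists l k)) (applyUpTo suc k)

inI : {r : ℕ} → ℤ → ℕ → ℕ → Vec ℕ r → List ℕ → Bool
inI j k l h p = (weight p ≡ᵇ k) ∧ (length p ≡ᵇ l) ∧ heightsFrom 1 h p ∧ firstOK j p

-- I_j(k,l,h) as a (duplicate-free) list: every index of weight k and
-- depth l has entries in {1,…,k}
I : {r : ℕ} → ℤ → ℕ → ℕ → Vec ℕ r → List (List ℕ)
I j k l h = filterᵇ (inI j k l h) (lists l k)

G : {r : ℕ} → ℤ → ℕ → ℕ → Vec ℕ r → Ser
G j k l h = sumSer (map Lit (I j k l h))

open import Data.Fin as Fin using (Fin)
Decreasing : {r : ℕ} → Vec ℕ r → Set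
Decreasing {zero}  h = Data.Unit.⊤ where import Data.Unit
Decreasing {suc r} h = (i : Fin r) → Vec.lookup h (Fin.suc i) ℕ.≤ Vec.lookup h (Fin.inject₁ i)

module Submission where

-- Multiplying by [n+1] undoes one factor 1/[n+1]; hence
--   z·D_q Li_{(a+1,p)} = Li_{(a,p)},   Li_{(0,p)} = z/(1-z) · Li_p,
-- and, since every summand of Li^t_k starts with k₁ or with k₁ + k₂,
--   z·D_q Li^t_{(a+1,k)} = Li^t_{(a,k)},
--   Li^t_{(0,b,k)} = (t + z/(1-z)) · Li^t_{(b,k)}.
--
-- G^t_j(k,l,h) is the sum of Li^t_p over all lists p
-- of depth l with entries ≤ k, weighted by the indicator of I_j(k,l,h).
-- Grouping by the first entry, z·D_q lowers k₁ by one, and each part of the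
-- lemma reduces to an identity between the indicators of (k₁+1, p) and of
-- (k₁, p): lowering k₁ changes only the condition k₁ ≥ j+2 and, exactly when
-- k₁ = j+2, the j+1-height.  Part (iii) instead isolates the indices with
-- k₁ = 1 and uses the formula for Li^t_{(0,b,k)}.

open import Defs
open import Data.Nat using (ℕ; suc; _+_; _∸_; _≤_)
open import Data.Integer as ℤ using (+_; -[1+_])
open import Data.Fin as Fin using (Fin; toℕ; fromℕ)
open import Data.Vec using (Vec; head; last; lookup; updateAt; sum)
open import Data.Product using (_×_)

open import Data.Nat using (zero; _<_; _<ᵇ_; _≤ᵇ_; _≡ᵇ_; _%_; z≤n; s≤s)
import Data.Nat.Properties as ℕₚ
open import Data.Nat.DivMod using (m≤n⇒m%n≡m; [m+n]%n≡m%n)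
open import Data.Integer using (ℤ)
import Data.Integer.Properties as ℤₚ
open import Data.Integer.Tactic.RingSolver using (solve-∀)
open import Data.Bool using (Bool; true; false; if_then_else_; _∧_; T)
open import Data.List using (List; []; _∷_; _++_; map; concatMap; applyUpTo; filterᵇ; length)
open import Data.List.Properties using (map-++)
open import Data.Vec using ([]; _∷_)
open import Data.Fin.Properties using (toℕ-fromℕ)
open import Data.Product using (_,_; proj₁; proj₂)
open import Data.Empty using (⊥; ⊥-elim)
open import Function using (_∘_)
open import Relation.Binary.Definitions using (tri<; tri≈; tri>)
open import Relation.Binary.PropositionalEquality
open import Relation.Nullary.Decidable using (isYes≗does)

QSeries : Set
QSeries = ℕ → ℤ

sumℤ-cong< : ∀ {f g : ℕ → ℤ} n → (∀ i → i < n → f i ≡ g i) → sumℤ f n ≡ sumℤ g n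
sumℤ-cong< zero    f≡g = refl
sumℤ-cong< (suc n) f≡g =
  cong₂ ℤ._+_ (sumℤ-cong< n (λ i i<n → f≡g i (ℕₚ.m<n⇒m<1+n i<n))) (f≡g n ℕₚ.≤-refl)

sumℤ-cong : ∀ {f g : ℕ → ℤ} n → (∀ i → f i ≡ g i) → sumℤ f n ≡ sumℤ g n
sumℤ-cong n f≡g = sumℤ-cong< n (λ i _ → f≡g i)

sumℤ-zero : ∀ {f : ℕ → ℤ} n → (∀ i → f i ≡ + 0) → sumℤ f n ≡ + 0
sumℤ-zero zero    f≡0 = refl
sumℤ-zero (suc n) f≡0 rewrite sumℤ-zero n f≡0 | f≡0 n = refl

sumℤ-+ : ∀ (f g : ℕ → ℤ) n → sumℤ (λ i → f i ℤ.+ g i) n ≡ sumℤ f n ℤ.+ sumℤ g n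
sumℤ-+ f g zero    = refl
sumℤ-+ f g (suc n) rewrite sumℤ-+ f g n = interchange (sumℤ f n) (sumℤ g n) (f n) (g n)
  where
  interchange : ∀ a b c d → (a ℤ.+ b) ℤ.+ (c ℤ.+ d) ≡ (a ℤ.+ c) ℤ.+ (b ℤ.+ d)
  interchange = solve-∀

sumℤ-head : ∀ (f : ℕ → ℤ) n → sumℤ f (suc n) ≡ f 0 ℤ.+ sumℤ (f ∘ suc) n
sumℤ-head f zero    = ℤₚ.+-comm (+ 0) (f 0)
sumℤ-head f (suc n) rewrite sumℤ-head f n = ℤₚ.+-assoc (f 0) (sumℤ (f ∘ suc) n) (f (suc n))

sumℤ-*ˡ : ∀ a (f : ℕ → ℤ) n → sumℤ (λ i → a ℤ.* f i) n ≡ a ℤ.* sumℤ f n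
sumℤ-*ˡ a f zero    = sym (ℤₚ.*-zeroʳ a)
sumℤ-*ˡ a f (suc n) rewrite sumℤ-*ˡ a f n = sym (ℤₚ.*-distribˡ-+ a (sumℤ f n) (f n))

sumℤ-*ʳ : ∀ a (f : ℕ → ℤ) n → sumℤ (λ i → f i ℤ.* a) n ≡ sumℤ f n ℤ.* a
sumℤ-*ʳ a f zero    = refl
sumℤ-*ʳ a f (suc n) rewrite sumℤ-*ʳ a f n = sym (ℤₚ.*-distribʳ-+ a (sumℤ f n) (f n))

sumℤ-triangle : ∀ (F : ℕ → ℕ → ℤ) n →
  sumℤ (λ m → sumℤ (λ i → F i m) (suc m)) n ≡ sumℤ (λ i → sumℤ (λ j → F i (i + j)) (n ∸ i)) n
sumℤ-triangle F zero    = refl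
sumℤ-triangle F (suc n) = begin
    sumℤ (λ m → sumℤ (λ i → F i m) (suc m)) n ℤ.+ (sumℤ (λ i → F i n) n ℤ.+ F n n)
  ≡⟨ cong (ℤ._+ (sumℤ (λ i → F i n) n ℤ.+ F n n)) (sumℤ-triangle F n) ⟩
    rows n ℤ.+ (sumℤ (λ i → F i n) n ℤ.+ F n n)
  ≡⟨ sym (ℤₚ.+-assoc (rows n) _ _) ⟩
    (rows n ℤ.+ sumℤ (λ i → F i n) n) ℤ.+ F n n
  ≡⟨ cong₂ ℤ._+_ (sym (trans (sumℤ-cong< n row-grows) (sumℤ-+ _ _ n))) last-row ⟩
    sumℤ (λ i → sumℤ (λ j → F i (i + j)) (suc n ∸ i)) n ℤ.+ sumℤ (λ j → F n (n + j)) (suc n ∸ n)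
  ∎
  where
  open ≡-Reasoning
  rows : ℕ → ℤ
  rows n = sumℤ (λ i → sumℤ (λ j → F i (i + j)) (n ∸ i)) n
  row-grows : ∀ i → i < n →
    sumℤ (λ j → F i (i + j)) (suc n ∸ i) ≡ sumℤ (λ j → F i (i + j)) (n ∸ i) ℤ.+ F i n
  row-grows i i<n rewrite ℕₚ.+-∸-assoc 1 (ℕₚ.<⇒≤ i<n) | ℕₚ.m+[n∸m]≡n (ℕₚ.<⇒≤ i<n) = refl
  last-row : F n n ≡ sumℤ (λ j → F n (n + j)) (suc n ∸ n)
  last-row rewrite ℕₚ.+-∸-assoc 1 (ℕₚ.≤-refl {n}) | ℕₚ.n∸n≡0 n | ℕₚ.+-identityʳ n =
    sym (ℤₚ.+-identityˡ (F n n))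

conv : QSeries → QSeries → QSeries
conv u v b = sumℤ (λ i → u i ℤ.* v (b ∸ i)) (suc b)

conv-cong : ∀ {u u′ v v′ : QSeries} → (∀ i → u i ≡ u′ i) → (∀ i → v i ≡ v′ i) →
  ∀ b → conv u v b ≡ conv u′ v′ b
conv-cong u≡ v≡ b = sumℤ-cong (suc b) (λ i → cong₂ ℤ._*_ (u≡ i) (v≡ (b ∸ i)))

conv-congʳ : ∀ (u : QSeries) {v v′ : QSeries} → (∀ i → v i ≡ v′ i) → ∀ b → conv u v b ≡ conv u v′ b
conv-congʳ u v≡ = conv-cong {u} {u} (λ _ → refl) v≡

conv-congˡ : ∀ {u u′ : QSeries} (v : QSeries) → (∀ i → u i ≡ u′ i) → ∀ b → conv u v b ≡ conv u′ v b
conv-congˡ v u≡ = conv-cong {v = v} {v} u≡ (λ _ → refl)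

conv-distribˡ : ∀ (u v w : QSeries) b → conv u (λ x → v x ℤ.+ w x) b ≡ conv u v b ℤ.+ conv u w b
conv-distribˡ u v w b =
  trans (sumℤ-cong (suc b) (λ i → ℤₚ.*-distribˡ-+ (u i) (v (b ∸ i)) (w (b ∸ i)))) (sumℤ-+ _ _ (suc b))

conv-zeroʳ : ∀ (u v : QSeries) → (∀ i → v i ≡ + 0) → ∀ b → conv u v b ≡ + 0
conv-zeroʳ u v v≡0 b =
  sumℤ-zero (suc b) (λ i → trans (cong (u i ℤ.*_) (v≡0 (b ∸ i))) (ℤₚ.*-zeroʳ (u i)))

δ : QSeries
δ = oneC 0

conv-identityˡ : ∀ (v : QSeries) b → conv δ v b ≡ v b
conv-identityˡ v b = begin
  conv δ v b                          ≡⟨ sumℤ-head _ b ⟩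
  + 1 ℤ.* v b ℤ.+ sumℤ (λ _ → + 0) b  ≡⟨ cong₂ ℤ._+_ (ℤₚ.*-identityˡ (v b)) (sumℤ-zero b (λ _ → refl)) ⟩
  v b ℤ.+ + 0                         ≡⟨ ℤₚ.+-identityʳ (v b) ⟩
  v b                                 ∎
  where open ≡-Reasoning

conv-assoc : ∀ (u v w : QSeries) b → conv (conv u v) w b ≡ conv u (conv v w) b
conv-assoc u v w b = begin
    sumℤ (λ m → conv u v m ℤ.* w (b ∸ m)) (suc b)
  ≡⟨ sumℤ-cong (suc b) (λ m → sym (sumℤ-*ʳ (w (b ∸ m)) _ (suc m))) ⟩
    sumℤ (λ m → sumℤ (λ i → (u i ℤ.* v (m ∸ i)) ℤ.* w (b ∸ m)) (suc m)) (suc b)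
  ≡⟨ sumℤ-triangle (λ i m → (u i ℤ.* v (m ∸ i)) ℤ.* w (b ∸ m)) (suc b) ⟩
    sumℤ (λ i → sumℤ (λ j → (u i ℤ.* v (i + j ∸ i)) ℤ.* w (b ∸ (i + j))) (suc b ∸ i)) (suc b)
  ≡⟨ sumℤ-cong< (suc b) row ⟩
    sumℤ (λ i → u i ℤ.* conv v w (b ∸ i)) (suc b)
  ∎
  where
  open ≡-Reasoning
  row : ∀ i → i < suc b →
    sumℤ (λ j → (u i ℤ.* v (i + j ∸ i)) ℤ.* w (b ∸ (i + j))) (suc b ∸ i) ≡ u i ℤ.* conv v w (b ∸ i)
  row i (s≤s i≤b) rewrite ℕₚ.+-∸-assoc 1 i≤b =
    trans (sumℤ-cong (suc (b ∸ i)) (λ j →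
             trans (cong₂ (λ x y → (u i ℤ.* v x) ℤ.* w y) (ℕₚ.m+n∸m≡n i j) (sym (ℕₚ.∸-+-assoc b i j)))
                   (ℤₚ.*-assoc (u i) _ _)))
          (sumℤ-*ˡ (u i) _ (suc (b ∸ i)))

ind : Bool → ℤ
ind b = if b then + 1 else + 0

≤ᵇ-suc : ∀ m n → (suc m ≤ᵇ suc n) ≡ (m ≤ᵇ n)
≤ᵇ-suc zero    n = refl
≤ᵇ-suc (suc m) n = refl

-- If d = (1 - q) g then [M] · d = (1 - q^M) g.
qint-telescope : ∀ (g d : QSeries) → d 0 ≡ g 0 → (∀ b → d (suc b) ≡ g (suc b) ℤ.- g b) →
  ∀ M b → sumℤ (λ i → ind (i <ᵇ M) ℤ.* d (b ∸ i)) (suc b)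
          ≡ g b ℤ.- (if M ≤ᵇ b then g (b ∸ M) else + 0)
qint-telescope g d d₀ dₛ zero    b       =
  trans (sumℤ-zero (suc b) (λ i → refl)) (sym (ℤₚ.+-inverseʳ (g b)))
qint-telescope g d d₀ dₛ (suc M) zero    =
  trans (ℤₚ.+-identityˡ _) (trans (ℤₚ.*-identityˡ (d 0)) (trans d₀ (sym (ℤₚ.+-identityʳ (g 0)))))
qint-telescope g d d₀ dₛ (suc M) (suc b) =
  trans (sumℤ-head _ (suc b))
  (trans (cong₂ ℤ._+_ (trans (ℤₚ.*-identityˡ _) (dₛ b)) (qint-telescope g d d₀ dₛ M b))
  (trans (cancel (g (suc b)) (g b) _)
         (cong (λ c → g (suc b) ℤ.- (if c then g (b ∸ M) else + 0)) (sym (≤ᵇ-suc M b)))))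
  where
  cancel : ∀ x y z → (x ℤ.- y) ℤ.+ (y ℤ.- z) ≡ x ℤ.- z
  cancel = solve-∀

geo-periodic : ∀ n b → suc n ≤ b → geo n b ≡ geo n (b ∸ suc n)
geo-periodic n b n<b = cong (λ x → if x ≡ᵇ 0 then + 1 else + 0)
  (trans (cong (_% suc n) (sym (ℕₚ.m∸n+n≡m n<b))) ([m+n]%n≡m%n (b ∸ suc n) (suc n)))

qint-invq : ∀ n b → conv (qint (suc n) 0) (invq n 0) b ≡ δ b
qint-invq n b = trans (qint-telescope (geo n) (invq n 0) refl (λ _ → refl) (suc n) b) (result (suc n ≤ᵇ b) refl)
  where
  geo-initial : ∀ b → b < suc n → geo n b ≡ δ b
  geo-initial zero    _         = refl
  geo-initial (suc b) (s≤s b<n) rewrite m≤n⇒m%n≡m {suc b} {n} b<n = refl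
  result : ∀ c → (suc n ≤ᵇ b) ≡ c → geo n b ℤ.- (if c then geo n (b ∸ suc n) else + 0) ≡ δ b
  result true  n<b with ℕₚ.≤ᵇ⇒≤ (suc n) b (subst T (sym n<b) _)
  ... | n<b′@(s≤s _) = trans (cong (ℤ._- geo n (b ∸ suc n)) (geo-periodic n b n<b′))
                             (ℤₚ.+-inverseʳ (geo n (b ∸ suc n)))
  result false b≤n = trans (ℤₚ.+-identityʳ (geo n b))
    (geo-initial b (ℕₚ.≰⇒> (λ n<b → subst T b≤n (ℕₚ.≤⇒≤ᵇ n<b))))

TFree : C → Set
TFree x = ∀ c b → x (suc c) b ≡ + 0

⊗-tfree : ∀ x y → TFree x → ∀ c b → (x ⊗ y) c b ≡ conv (x 0) (y c) b
⊗-tfree x y x-tfree c b = trans (sumℤ-head _ c)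
  (trans (cong (ℤ._+_ (conv (x 0) (y c) b))
               (sumℤ-zero c (λ c₁ → sumℤ-zero (suc b) (λ b₁ → cong (ℤ._* _) (x-tfree c₁ b₁)))))
         (ℤₚ.+-identityʳ _))

⊗-preserves-tfree : ∀ x y → TFree x → TFree y → TFree (x ⊗ y)
⊗-preserves-tfree x y x-tfree y-tfree c b =
  trans (⊗-tfree x y x-tfree (suc c) b) (conv-zeroʳ (x 0) (y (suc c)) (y-tfree c) b)

powC-tfree : ∀ x k → TFree x → TFree (powC x k)
powC-tfree x zero    x-tfree c b = refl
powC-tfree x (suc k) x-tfree     = ⊗-preserves-tfree x (powC x k) x-tfree (powC-tfree x k x-tfree)

oneC-⊗ : ∀ y c b → (oneC ⊗ y) c b ≡ y c b
oneC-⊗ y c b = trans (⊗-tfree oneC y (λ _ _ → refl) c b) (conv-identityˡ (y c) b)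

qint-⊗-tpow : ∀ N e y c b → (qint N ⊗ tpow e y) c b ≡ tpow e (qint N ⊗ y) c b
qint-⊗-tpow N e y c b with e ≤ᵇ c in e≤c
... | true  = trans (⊗-tfree (qint N) (tpow e y) (λ _ _ → refl) c b)
              (trans (conv-congʳ (qint N 0) (λ b′ → cong (λ t → if t then y (c ∸ e) b′ else + 0) e≤c) b)
                     (sym (⊗-tfree (qint N) y (λ _ _ → refl) (c ∸ e) b)))
... | false = trans (⊗-tfree (qint N) (tpow e y) (λ _ _ → refl) c b)
                    (conv-zeroʳ (qint N 0) (tpow e y c)
                       (λ b′ → cong (λ t → if t then y (c ∸ e) b′ else + 0) e≤c) b)

qint-cancels-invq : ∀ n a S c b →
  (qint (suc n) ⊗ (powC (invq n) (suc a) ⊗ S)) c b ≡ (powC (invq n) a ⊗ S) c b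
qint-cancels-invq n a S c b = begin
    (qint (suc n) ⊗ ((invq n ⊗ P) ⊗ S)) c b
  ≡⟨ ⊗-tfree (qint (suc n)) ((invq n ⊗ P) ⊗ S) (λ _ _ → refl) c b ⟩
    conv [n+1] (((invq n ⊗ P) ⊗ S) c) b
  ≡⟨ conv-congʳ [n+1] (λ b′ →
       trans (⊗-tfree (invq n ⊗ P) S (⊗-preserves-tfree (invq n) P (λ _ _ → refl) P-tfree) c b′)
       (trans (conv-congˡ (S c) (λ i → ⊗-tfree (invq n) P (λ _ _ → refl) 0 i) b′)
              (conv-assoc (invq n 0) (P 0) (S c) b′))) b ⟩
    conv [n+1] (conv (invq n 0) (conv (P 0) (S c))) b
  ≡⟨ sym (conv-assoc [n+1] (invq n 0) (conv (P 0) (S c)) b) ⟩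
    conv (conv [n+1] (invq n 0)) (conv (P 0) (S c)) b
  ≡⟨ conv-congˡ (conv (P 0) (S c)) (qint-invq n) b ⟩
    conv δ (conv (P 0) (S c)) b
  ≡⟨ conv-identityˡ (conv (P 0) (S c)) b ⟩
    conv (P 0) (S c) b
  ≡⟨ sym (⊗-tfree P S P-tfree c b) ⟩
    (P ⊗ S) c b
  ∎
  where
  open ≡-Reasoning
  P = powC (invq n) a
  P-tfree = powC-tfree (invq n) a (λ _ _ → refl)
  [n+1] = qint (suc n) 0

0ˢ : Ser
0ˢ _ = zeroC

ite : Bool → Ser → Ser
ite b f = if b then f else 0ˢ

≋-refl : ∀ {f} → f ≋ f
≋-refl N c b = refl

≋-sym : ∀ {f g} → f ≋ g → g ≋ f
≋-sym f≋g N c b = sym (f≋g N c b)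

≋-trans : ∀ {f g h} → f ≋ g → g ≋ h → f ≋ h
≋-trans f≋g g≋h N c b = trans (f≋g N c b) (g≋h N c b)

infixr 2 _≋⟨_⟩_
infix  3 _∎ˢ

_≋⟨_⟩_ : ∀ f {g h} → f ≋ g → g ≋ h → f ≋ h
f ≋⟨ f≋g ⟩ g≋h = ≋-trans f≋g g≋h

_∎ˢ : ∀ f → f ≋ f
f ∎ˢ = ≋-refl

⊕-cong : ∀ {f f′ g g′} → f ≋ f′ → g ≋ g′ → (f ⊕ˢ g) ≋ (f′ ⊕ˢ g′)
⊕-cong f≋ g≋ N c b = cong₂ ℤ._+_ (f≋ N c b) (g≋ N c b)

⊖-cong : ∀ {f f′ g g′} → f ≋ f′ → g ≋ g′ → (f ⊖ˢ g) ≋ (f′ ⊖ˢ g′)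
⊖-cong f≋ g≋ N c b = cong₂ (λ x y → x ℤ.+ ℤ.- y) (f≋ N c b) (g≋ N c b)

ite-cong : ∀ b {f g} → f ≋ g → ite b f ≋ ite b g
ite-cong true  f≋g = f≋g
ite-cong false f≋g = ≋-refl

ite-condition : ∀ {b b′} (f : Ser) → b ≡ b′ → ite b f ≋ ite b′ f
ite-condition f refl = ≋-refl

ite⊖ite : ∀ b f → (ite b f ⊖ˢ ite b f) ≋ 0ˢ
ite⊖ite b f N c x = ℤₚ.+-inverseʳ (ite b f N c x)

record Linear (L : Ser → Ser) : Set where
  field
    L-cong : ∀ {f g} → f ≋ g → L f ≋ L g
    L-⊕    : ∀ f g → L (f ⊕ˢ g) ≋ (L f ⊕ˢ L g)
    L-0    : L 0ˢ ≋ 0ˢ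

  L-⊖ : ∀ f g → L (f ⊖ˢ g) ≋ (L f ⊖ˢ L g)
  L-⊖ f g N c b = trans (add-sub (L (f ⊖ˢ g) N c b) (L g N c b))
    (cong (ℤ._- L g N c b) (trans (sym (L-⊕ (f ⊖ˢ g) g N c b))
                                  (L-cong (λ N′ c′ b′ → sub-add (f N′ c′ b′) (g N′ c′ b′)) N c b)))
    where
    add-sub : ∀ x y → x ≡ (x ℤ.+ y) ℤ.- y
    add-sub = solve-∀
    sub-add : ∀ x y → (x ℤ.- y) ℤ.+ y ≡ x
    sub-add = solve-∀

  L-sumSer : ∀ {A : Set} (F : A → Ser) xs → L (sumSer (map F xs)) ≋ sumSer (map (L ∘ F) xs)
  L-sumSer F []       = L-0
  L-sumSer F (x ∷ xs) = ≋-trans (L-⊕ (F x) (sumSer (map F xs)))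
                                (λ N c b → cong (ℤ._+_ (L (F x) N c b)) (L-sumSer F xs N c b))

  L-ite : ∀ b f → L (ite b f) ≋ ite b (L f)
  L-ite true  f = ≋-refl
  L-ite false f = L-0

open Linear

zDq-coeff : ∀ f N c b → zDq f N c b ≡ conv (qint N 0) (f N c) b
zDq-coeff f N = ⊗-tfree (qint N) (f N) (λ _ _ → refl)

zDq-linear : Linear zDq
zDq-linear .L-cong {f} {g} f≋g N c b =
  trans (zDq-coeff f N c b) (trans (conv-congʳ (qint N 0) (f≋g N c) b) (sym (zDq-coeff g N c b)))
zDq-linear .L-⊕ f g N c b =
  trans (zDq-coeff (f ⊕ˢ g) N c b)
        (trans (conv-distribˡ (qint N 0) (f N c) (g N c) b)
               (sym (cong₂ ℤ._+_ (zDq-coeff f N c b) (zDq-coeff g N c b))))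
zDq-linear .L-0 N c b = trans (zDq-coeff 0ˢ N c b) (conv-zeroʳ (qint N 0) (λ _ → + 0) (λ _ → refl) b)

t-linear : Linear tˢ
t-linear .L-cong f≋g N zero    b = refl
t-linear .L-cong f≋g N (suc c) b = f≋g N c b
t-linear .L-⊕ f g N zero    b = refl
t-linear .L-⊕ f g N (suc c) b = refl
t-linear .L-0 N zero    b = refl
t-linear .L-0 N (suc c) b = refl

zOver1-z-linear : Linear zOver1-z
zOver1-z-linear .L-cong f≋g zero    c b = refl
zOver1-z-linear .L-cong f≋g (suc N) c b = cong₂ ℤ._+_ (zOver1-z-linear .L-cong f≋g N c b) (f≋g N c b)
zOver1-z-linear .L-⊕ f g zero    c b = refl
zOver1-z-linear .L-⊕ f g (suc N) c b =
  trans (cong (ℤ._+ (f N c b ℤ.+ g N c b)) (zOver1-z-linear .L-⊕ f g N c b))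
        (interchange (sumC f N c b) (sumC g N c b) (f N c b) (g N c b))
  where
  interchange : ∀ a b c d → (a ℤ.+ b) ℤ.+ (c ℤ.+ d) ≡ (a ℤ.+ c) ℤ.+ (b ℤ.+ d)
  interchange = solve-∀
zOver1-z-linear .L-0 zero    c b = refl
zOver1-z-linear .L-0 (suc N) c b = trans (ℤₚ.+-identityʳ _) (zOver1-z-linear .L-0 N c b)

tˢ^ : ℕ → Ser → Ser
tˢ^ e f N = tpow e (f N)

tˢ^-linear : ∀ e → Linear (tˢ^ e)
tˢ^-linear e .L-cong f≋g N c b with e ≤ᵇ c
... | true  = f≋g N (c ∸ e) b
... | false = refl
tˢ^-linear e .L-⊕ f g N c b with e ≤ᵇ c
... | true  = refl
... | false = refl
tˢ^-linear e .L-0 N c b with e ≤ᵇ c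
... | true  = refl
... | false = refl

tˢ^-zOver1-z : ∀ e f → tˢ^ e (zOver1-z f) ≋ zOver1-z (tˢ^ e f)
tˢ^-zOver1-z e f zero    c b with e ≤ᵇ c
... | true  = refl
... | false = refl
tˢ^-zOver1-z e f (suc N) c b =
  trans (tˢ^-linear e .L-⊕ (zOver1-z f) f N c b) (cong (ℤ._+ tˢ^ e f N c b) (tˢ^-zOver1-z e f N c b))

tˢ^-suc : ∀ e f → tˢ^ (suc e) f ≋ tˢ (tˢ^ e f)
tˢ^-suc e f N zero    b = refl
tˢ^-suc e f N (suc c) b rewrite ≤ᵇ-suc e c = refl

zDq-tˢ : ∀ f → zDq (tˢ f) ≋ tˢ (zDq f)
zDq-tˢ f N = qint-⊗-tpow N 1 (f N)

zDq-tˢ^ : ∀ e f → zDq (tˢ^ e f) ≋ tˢ^ e (zDq f)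
zDq-tˢ^ e f N = qint-⊗-tpow N e (f N)

sumSer-++ : ∀ (xs ys : List Ser) → sumSer (xs ++ ys) ≋ (sumSer xs ⊕ˢ sumSer ys)
sumSer-++ []       ys N c b = sym (ℤₚ.+-identityˡ _)
sumSer-++ (x ∷ xs) ys N c b =
  trans (cong (ℤ._+_ (x N c b)) (sumSer-++ xs ys N c b)) (sym (ℤₚ.+-assoc (x N c b) _ _))

sumMap-cong : ∀ {A : Set} {F G : A → Ser} xs → (∀ x → F x ≋ G x) → sumSer (map F xs) ≋ sumSer (map G xs)
sumMap-cong []       F≋G = ≋-refl
sumMap-cong (x ∷ xs) F≋G N c b = cong₂ ℤ._+_ (F≋G x N c b) (sumMap-cong xs F≋G N c b)

sumMap-zero : ∀ {A : Set} (F : A → Ser) xs → (∀ x → F x ≋ 0ˢ) → sumSer (map F xs) ≋ 0ˢ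
sumMap-zero F []       F≋0 = ≋-refl
sumMap-zero F (x ∷ xs) F≋0 N c b rewrite F≋0 x N c b | sumMap-zero F xs F≋0 N c b = refl

sumMap-⊕ : ∀ {A : Set} (F G : A → Ser) xs →
  sumSer (map (λ x → F x ⊕ˢ G x) xs) ≋ (sumSer (map F xs) ⊕ˢ sumSer (map G xs))
sumMap-⊕ F G []       N c b = refl
sumMap-⊕ F G (x ∷ xs) N c b =
  trans (cong (ℤ._+_ (F x N c b ℤ.+ G x N c b)) (sumMap-⊕ F G xs N c b))
        (interchange (F x N c b) (G x N c b) (sumSer (map F xs) N c b) (sumSer (map G xs) N c b))
  where
  interchange : ∀ a b c d → (a ℤ.+ b) ℤ.+ (c ℤ.+ d) ≡ (a ℤ.+ c) ℤ.+ (b ℤ.+ d)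
  interchange = solve-∀

sumMap-⊖ : ∀ {A : Set} (F G : A → Ser) xs →
  sumSer (map (λ x → F x ⊖ˢ G x) xs) ≋ (sumSer (map F xs) ⊖ˢ sumSer (map G xs))
sumMap-⊖ F G []       N c b = refl
sumMap-⊖ F G (x ∷ xs) N c b =
  trans (cong (ℤ._+_ (F x N c b ℤ.- G x N c b)) (sumMap-⊖ F G xs N c b))
        (interchange (F x N c b) (G x N c b) (sumSer (map F xs) N c b) (sumSer (map G xs) N c b))
  where
  interchange : ∀ a b c d → (a ℤ.- b) ℤ.+ (c ℤ.- d) ≡ (a ℤ.+ c) ℤ.- (b ℤ.+ d)
  interchange = solve-∀

sumMap-map : ∀ {A B : Set} (F : B → Ser) (g : A → B) xs → sumSer (map F (map g xs)) ≋ sumSer (map (F ∘ g) xs)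
sumMap-map F g []       = ≋-refl
sumMap-map F g (x ∷ xs) N c b = cong (ℤ._+_ (F (g x) N c b)) (sumMap-map F g xs N c b)

sumMap-filter : ∀ {A : Set} (F : A → Ser) (P : A → Bool) xs →
  sumSer (map F (filterᵇ P xs)) ≋ sumSer (map (λ x → ite (P x) (F x)) xs)
sumMap-filter F P []       = ≋-refl
sumMap-filter F P (x ∷ xs) with P x
... | true  = λ N c b → cong (ℤ._+_ (F x N c b)) (sumMap-filter F P xs N c b)
... | false = λ N c b → trans (sumMap-filter F P xs N c b) (sym (ℤₚ.+-identityˡ _))

sumMap-concatMap : ∀ {A B : Set} (F : B → Ser) (h : A → List B) xs →
  sumSer (map F (concatMap h xs)) ≋ sumSer (map (λ a → sumSer (map F (h a))) xs)
sumMap-concatMap F h []       = ≋-refl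
sumMap-concatMap F h (x ∷ xs) =
  ≋-trans (λ N c b → cong (λ ys → sumSer ys N c b) (map-++ F (h x) (concatMap h xs)))
  (≋-trans (sumSer-++ (map F (h x)) (map F (concatMap h xs)))
           (λ N c b → cong (ℤ._+_ (sumSer (map F (h x)) N c b)) (sumMap-concatMap F h xs N c b)))

zDq-Li : ∀ a p → zDq (Li (suc a ∷ p)) ≋ Li (a ∷ p)
zDq-Li a p zero    c b = trans (zDq-coeff (Li (suc a ∷ p)) 0 c b)
                               (conv-zeroʳ (qint 0 0) (λ _ → + 0) (λ _ → refl) b)
zDq-Li a p (suc n) c b = qint-cancels-invq n a (sumC (LiCoeff p) (suc n)) c b

Li-zero-head : ∀ p → Li (0 ∷ p) ≋ zOver1-z (Li p)
Li-zero-head p zero    c b = refl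
Li-zero-head p (suc n) c b = oneC-⊗ (sumC (LiCoeff p) (suc n)) c b

term : List ℕ × ℕ → Ser
term x = tˢ^ (proj₂ x) (Li (proj₁ x))

termSum : List (List ℕ × ℕ) → Ser
termSum xs = sumSer (map term xs)

consTermSum : ℕ → List (List ℕ × ℕ) → Ser
consTermSum c xs = sumSer (map (λ x → term (c ∷ proj₁ x , proj₂ x)) xs)

Lit-termSum : ∀ ks → Lit ks ≋ termSum (merges ks)
Lit-termSum ks = sumMap-cong (merges ks) (λ _ → ≋-refl)

mergeFrom-split : ∀ c b bs →
  termSum (mergeFrom c (b ∷ bs)) ≋ (consTermSum c (mergeFrom b bs) ⊕ˢ tˢ (termSum (mergeFrom (c + b) bs)))
mergeFrom-split c b bs =
  ≋-trans (λ N c′ b′ → cong (λ ys → sumSer ys N c′ b′) (map-++ term (map consFirst M) (map bumpT M′)))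
  (≋-trans (sumSer-++ (map term (map consFirst M)) (map term (map bumpT M′)))
           (⊕-cong (sumMap-map term consFirst M)
                   (≋-trans (sumMap-map term bumpT M′)
                   (≋-trans (sumMap-cong M′ (λ x → tˢ^-suc (proj₂ x) (Li (proj₁ x))))
                            (≋-sym (L-sumSer t-linear term M′))))))
  where
  M  = mergeFrom b bs
  M′ = mergeFrom (c + b) bs
  consFirst bumpT : List ℕ × ℕ → List ℕ × ℕ
  consFirst x = (c ∷ proj₁ x , proj₂ x)
  bumpT x = (proj₁ x , suc (proj₂ x))

zDq-consTermSum : ∀ a xs → zDq (consTermSum (suc a) xs) ≋ consTermSum a xs
zDq-consTermSum a xs =
  ≋-trans (L-sumSer zDq-linear (λ x → term (suc a ∷ proj₁ x , proj₂ x)) xs)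
          (sumMap-cong xs (λ x → ≋-trans (zDq-tˢ^ (proj₂ x) (Li (suc a ∷ proj₁ x)))
                                         (tˢ^-linear (proj₂ x) .L-cong (zDq-Li a (proj₁ x)))))

zDq-mergeFrom : ∀ bs a → zDq (termSum (mergeFrom (suc a) bs)) ≋ termSum (mergeFrom a bs)
zDq-mergeFrom []       a = zDq-consTermSum a (([] , 0) ∷ [])
zDq-mergeFrom (b ∷ bs) a =
  zDq (termSum (mergeFrom (suc a) (b ∷ bs)))
    ≋⟨ zDq-linear .L-cong (mergeFrom-split (suc a) b bs) ⟩
  zDq (consTermSum (suc a) (mergeFrom b bs) ⊕ˢ tˢ (termSum (mergeFrom (suc (a + b)) bs)))
    ≋⟨ zDq-linear .L-⊕ (consTermSum (suc a) (mergeFrom b bs)) (tˢ (termSum (mergeFrom (suc (a + b)) bs))) ⟩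
  (zDq (consTermSum (suc a) (mergeFrom b bs)) ⊕ˢ zDq (tˢ (termSum (mergeFrom (suc (a + b)) bs))))
    ≋⟨ ⊕-cong (zDq-consTermSum a (mergeFrom b bs))
              (≋-trans (zDq-tˢ (termSum (mergeFrom (suc (a + b)) bs)))
                       (t-linear .L-cong (zDq-mergeFrom bs (a + b)))) ⟩
  (consTermSum a (mergeFrom b bs) ⊕ˢ tˢ (termSum (mergeFrom (a + b) bs)))
    ≋⟨ ≋-sym (mergeFrom-split a b bs) ⟩
  termSum (mergeFrom a (b ∷ bs)) ∎ˢ

zDq-Lit : ∀ a ks → zDq (Lit (suc a ∷ ks)) ≋ Lit (a ∷ ks)
zDq-Lit a ks = ≋-trans (zDq-linear .L-cong (Lit-termSum (suc a ∷ ks)))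
               (≋-trans (zDq-mergeFrom ks a) (≋-sym (Lit-termSum (a ∷ ks))))

Lit-zero-head : ∀ b bs → Lit (0 ∷ b ∷ bs) ≋ (tˢ (Lit (b ∷ bs)) ⊕ˢ zOver1-z (Lit (b ∷ bs)))
Lit-zero-head b bs =
  Lit (0 ∷ b ∷ bs)
    ≋⟨ Lit-termSum (0 ∷ b ∷ bs) ⟩
  termSum (mergeFrom 0 (b ∷ bs))
    ≋⟨ mergeFrom-split 0 b bs ⟩
  (consTermSum 0 M ⊕ˢ tˢ (termSum M))
    ≋⟨ ⊕-cong (≋-trans (sumMap-cong M (λ x → ≋-trans (tˢ^-linear (proj₂ x) .L-cong (Li-zero-head (proj₁ x)))
                                                      (tˢ^-zOver1-z (proj₂ x) (Li (proj₁ x)))))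
                       (≋-sym (L-sumSer zOver1-z-linear term M)))
              ≋-refl ⟩
  (zOver1-z (termSum M) ⊕ˢ tˢ (termSum M))
    ≋⟨ (λ N c b′ → ℤₚ.+-comm (zOver1-z (termSum M) N c b′) (tˢ (termSum M) N c b′)) ⟩
  (tˢ (termSum M) ⊕ˢ zOver1-z (termSum M))
    ≋⟨ ⊕-cong (t-linear .L-cong (≋-sym (Lit-termSum (b ∷ bs))))
              (zOver1-z-linear .L-cong (≋-sym (Lit-termSum (b ∷ bs)))) ⟩
  (tˢ (Lit (b ∷ bs)) ⊕ˢ zOver1-z (Lit (b ∷ bs))) ∎ˢ
  where M = mergeFrom b bs

sumUpTo : (ℕ → Ser) → ℕ → Ser
sumUpTo g n = sumSer (applyUpTo g n)

sumUpTo-cong : ∀ {g g′ : ℕ → Ser} n → (∀ i → g i ≋ g′ i) → sumUpTo g n ≋ sumUpTo g′ n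
sumUpTo-cong zero    g≋ = ≋-refl
sumUpTo-cong (suc n) g≋ N c b = cong₂ ℤ._+_ (g≋ 0 N c b) (sumUpTo-cong n (g≋ ∘ suc) N c b)

sumUpTo-zero : ∀ {g : ℕ → Ser} n → (∀ i → g i ≋ 0ˢ) → sumUpTo g n ≋ 0ˢ
sumUpTo-zero zero    g≋0 = ≋-refl
sumUpTo-zero (suc n) g≋0 N c b rewrite g≋0 0 N c b | sumUpTo-zero n (g≋0 ∘ suc) N c b = refl

sumUpTo-truncate : ∀ (g : ℕ → Ser) n m → n ≤ m → (∀ i → n ≤ i → g i ≋ 0ˢ) → sumUpTo g m ≋ sumUpTo g n
sumUpTo-truncate g zero    m       _         g≋0 = sumUpTo-zero m (λ i → g≋0 i z≤n)
sumUpTo-truncate g (suc n) (suc m) (s≤s n≤m) g≋0 N c b =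
  cong (ℤ._+_ (g 0 N c b)) (sumUpTo-truncate (g ∘ suc) n m n≤m (λ i n≤i → g≋0 (suc i) (s≤s n≤i)) N c b)

sumMap-applyUpTo : ∀ {A : Set} (F : A → Ser) (f : ℕ → A) n → sumSer (map F (applyUpTo f n)) ≋ sumUpTo (F ∘ f) n
sumMap-applyUpTo F f zero    = ≋-refl
sumMap-applyUpTo F f (suc n) N c b = cong (ℤ._+_ (F (f 0) N c b)) (sumMap-applyUpTo F (f ∘ suc) n N c b)

L-sumUpTo : ∀ {L} → Linear L → ∀ (g : ℕ → Ser) n → L (sumUpTo g n) ≋ sumUpTo (L ∘ g) n
L-sumUpTo lin g zero    = lin .L-0
L-sumUpTo {L} lin g (suc n) = ≋-trans (lin .L-⊕ (g 0) (sumUpTo (g ∘ suc) n))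
  (λ N c b → cong (ℤ._+_ (L (g 0) N c b)) (L-sumUpTo lin (g ∘ suc) n N c b))

sumOver : ℕ → ℕ → (List ℕ → Ser) → Ser
sumOver l K F = sumSer (map F (lists l K))

sumOver-byFirst : ∀ l K (F : List ℕ → Ser) →
  sumOver (suc l) K F ≋ sumUpTo (λ i → sumOver l K (λ ps → F (suc i ∷ ps))) K
sumOver-byFirst l K F =
  ≋-trans (sumMap-concatMap F (λ a → map (a ∷_) (lists l K)) (applyUpTo suc K))
  (≋-trans (sumMap-cong (applyUpTo suc K) (λ a → sumMap-map F (a ∷_) (lists l K)))
           (sumMap-applyUpTo (λ a → sumOver l K (λ ps → F (a ∷ ps))) suc K))

sumOver-cong : ∀ l K {F F′ : List ℕ → Ser} → (∀ ps → F ps ≋ F′ ps) → sumOver l K F ≋ sumOver l K F′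
sumOver-cong l K = sumMap-cong (lists l K)

-- Every list in lists (suc l) K starts with a positive entry.
sumOver-cong-cons : ∀ l K {F F′ : List ℕ → Ser} → (∀ i ps → F (suc i ∷ ps) ≋ F′ (suc i ∷ ps)) →
  sumOver (suc l) K F ≋ sumOver (suc l) K F′
sumOver-cong-cons l K {F} {F′} F≋ =
  ≋-trans (sumOver-byFirst l K F)
  (≋-trans (sumUpTo-cong K (λ i → sumOver-cong l K (F≋ i))) (≋-sym (sumOver-byFirst l K F′)))

sumOver-truncate : ∀ l K W (F : List ℕ → Ser) → W ≤ K → (∀ p → W < weight p → F p ≋ 0ˢ) →
  sumOver l K F ≋ sumOver l W F
sumOver-truncate zero    K W F W≤K F≋0 = ≋-refl
sumOver-truncate (suc l) K W F W≤K F≋0 =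
  ≋-trans (sumOver-byFirst l K F)
  (≋-trans (sumUpTo-truncate _ W K W≤K (λ i W≤i → sumMap-zero _ (lists l K) (λ ps →
              F≋0 (suc i ∷ ps) (ℕₚ.≤-trans (s≤s W≤i) (ℕₚ.m≤m+n (suc i) (weight ps))))))
  (≋-trans (sumUpTo-cong W (λ i → sumOver-truncate l K W (λ ps → F (suc i ∷ ps)) W≤K (λ ps W<w →
              F≋0 (suc i ∷ ps) (ℕₚ.≤-trans W<w (ℕₚ.m≤n+m (weight ps) (suc i))))))
           (≋-sym (sumOver-byFirst l W F))))

sumOver-firstEntryOne : ∀ l K′ (F : List ℕ → Ser) → (∀ i ps → F (suc (suc i) ∷ ps) ≋ 0ˢ) →
  sumOver (suc l) (suc K′) F ≋ sumOver l (suc K′) (λ ps → F (1 ∷ ps))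
sumOver-firstEntryOne l K′ F F≋0 =
  ≋-trans (sumOver-byFirst l (suc K′) F)
    (λ N c b → trans (cong (ℤ._+_ (sumOver l (suc K′) (λ ps → F (1 ∷ ps)) N c b))
                           (sumUpTo-zero K′ (λ i → sumMap-zero _ (lists l (suc K′)) (F≋0 i)) N c b))
                     (ℤₚ.+-identityʳ _))

zDq-sumOver-shift : ∀ l K′ (F G : List ℕ → Ser) →
  (∀ p → suc K′ < weight p → F p ≋ 0ˢ) →
  (∀ a ps → zDq (F (suc (suc a) ∷ ps)) ≋ G (suc a ∷ ps)) →
  (∀ ps → zDq (F (1 ∷ ps)) ≋ 0ˢ) →
  zDq (sumOver (suc l) (suc K′) F) ≋ sumOver (suc l) K′ G
zDq-sumOver-shift l K′ F G F-bounded zDq-F zDq-F₁ =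
  zDq (sumOver (suc l) (suc K′) F)
    ≋⟨ zDq-linear .L-cong (sumOver-byFirst l (suc K′) F) ⟩
  zDq (sumUpTo rowSum (suc K′))
    ≋⟨ L-sumUpTo zDq-linear rowSum (suc K′) ⟩
  (zDq (rowSum 0) ⊕ˢ sumUpTo (zDq ∘ rowSum ∘ suc) K′)
    ≋⟨ (λ N c b → trans (cong (ℤ._+ sumUpTo (zDq ∘ rowSum ∘ suc) K′ N c b) (firstRow N c b))
                         (ℤₚ.+-identityˡ _)) ⟩
  sumUpTo (zDq ∘ rowSum ∘ suc) K′
    ≋⟨ sumUpTo-cong K′ laterRow ⟩
  sumUpTo (λ i → sumOver l K′ (λ ps → G (suc i ∷ ps))) K′
    ≋⟨ ≋-sym (sumOver-byFirst l K′ G) ⟩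
  sumOver (suc l) K′ G ∎ˢ
  where
  rowSum : ℕ → Ser
  rowSum i = sumOver l (suc K′) (λ ps → F (suc i ∷ ps))
  firstRow : zDq (rowSum 0) ≋ 0ˢ
  firstRow = ≋-trans (L-sumSer zDq-linear (λ ps → F (1 ∷ ps)) (lists l (suc K′)))
                     (sumMap-zero _ (lists l (suc K′)) zDq-F₁)
  laterRow : ∀ i → zDq (rowSum (suc i)) ≋ sumOver l K′ (λ ps → G (suc i ∷ ps))
  laterRow i =
    ≋-trans (L-sumSer zDq-linear (λ ps → F (suc (suc i) ∷ ps)) (lists l (suc K′)))
    (≋-trans (sumOver-truncate l (suc K′) K′ (λ ps → zDq (F (suc (suc i) ∷ ps))) (ℕₚ.n≤1+n K′)
                (λ ps K′<w → ≋-trans (zDq-linear .L-cong (F-bounded (suc (suc i) ∷ ps)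
                                        (s≤s (ℕₚ.≤-trans K′<w (ℕₚ.m≤n+m (weight ps) (suc i))))))
                                     (zDq-linear .L-0)))
             (sumOver-cong l K′ (zDq-F i)))

true-if : ∀ {b} → T b → b ≡ true
true-if {true} _ = refl

false-if : ∀ {b} → (T b → ⊥) → b ≡ false
false-if {false} _   = refl
false-if {true}  ¬tt = ⊥-elim (¬tt _)

<ᵇ-true : ∀ {m n} → m < n → (m <ᵇ n) ≡ true
<ᵇ-true m<n = true-if (ℕₚ.<⇒<ᵇ m<n)

<ᵇ-false : ∀ {m n} → n ≤ m → (m <ᵇ n) ≡ false
<ᵇ-false {m} {n} n≤m = false-if (λ m<n → ℕₚ.<⇒≱ (ℕₚ.<ᵇ⇒< m n m<n) n≤m)

<ᵇ-lower : ∀ i y → (i ≡ y → ⊥) → (i <ᵇ suc y) ≡ (i <ᵇ y)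
<ᵇ-lower i y i≢y with ℕₚ.<-cmp i y
... | tri< i<y _ _ = trans (<ᵇ-true (ℕₚ.m<n⇒m<1+n i<y)) (sym (<ᵇ-true i<y))
... | tri≈ _ i≡y _ = ⊥-elim (i≢y i≡y)
... | tri> _ _ y<i = trans (<ᵇ-false y<i) (sym (<ᵇ-false (ℕₚ.<⇒≤ y<i)))

height-cons : ∀ i a ps → height i (a ∷ ps) ≡ (if i <ᵇ a then suc (height i ps) else height i ps)
height-cons i a ps with i <ᵇ a
... | true  = refl
... | false = refl

height-cons-cong : ∀ i a a′ ps → (i <ᵇ a) ≡ (i <ᵇ a′) → height i (a ∷ ps) ≡ height i (a′ ∷ ps)
height-cons-cong i a a′ ps eq =
  trans (height-cons i a ps)
        (trans (cong (λ c → if c then suc (height i ps) else height i ps) eq) (sym (height-cons i a′ ps)))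

heightsFrom-cong : ∀ {n} (v : Vec ℕ n) s p p′ → (∀ i → s ≤ i → i < s + n → height i p ≡ height i p′) →
  heightsFrom s v p ≡ heightsFrom s v p′
heightsFrom-cong []              s p p′ same = refl
heightsFrom-cong {suc n} (x ∷ v) s p p′ same =
  cong₂ _∧_ (cong (_≡ᵇ x) (same s ℕₚ.≤-refl (ℕₚ.m<m+n s (s≤s z≤n))))
            (heightsFrom-cong v (suc s) p p′ (λ i s<i i<s+n →
               same i (ℕₚ.≤-trans (ℕₚ.n≤1+n s) s<i) (subst (i <_) (sym (ℕₚ.+-suc s n)) i<s+n)))

heightsFrom-lower-away : ∀ {n} (v : Vec ℕ n) s y ps → (∀ i → s ≤ i → i < s + n → i ≡ y → ⊥) →
  heightsFrom s v (suc y ∷ ps) ≡ heightsFrom s v (y ∷ ps)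
heightsFrom-lower-away v s y ps away =
  heightsFrom-cong v s _ _ (λ i s≤i i<s+n → height-cons-cong i (suc y) y ps (<ᵇ-lower i y (away i s≤i i<s+n)))

height-cons-above : ∀ {i a} ps → i < a → height i (a ∷ ps) ≡ suc (height i ps)
height-cons-above {i} {a} ps i<a =
  trans (height-cons i a ps) (cong (λ c → if c then suc (height i ps) else height i ps) (<ᵇ-true i<a))

height-cons-below : ∀ {i a} ps → a ≤ i → height i (a ∷ ps) ≡ height i ps
height-cons-below {i} {a} ps a≤i =
  trans (height-cons i a ps) (cong (λ c → if c then suc (height i ps) else height i ps) (<ᵇ-false a≤i))

heightsFrom-lower-at : ∀ {n} (v : Vec ℕ n) (j : Fin n) s y ps → y ≡ s + toℕ j → 1 ≤ lookup v j →
  heightsFrom s v (suc y ∷ ps) ≡ heightsFrom s (updateAt v j (_∸ 1)) (y ∷ ps)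
heightsFrom-lower-at (suc x ∷ v) Fin.zero s y ps y≡s+0 (s≤s z≤n) rewrite trans y≡s+0 (ℕₚ.+-identityʳ s) =
  cong₂ _∧_ (trans (cong (_≡ᵇ suc x) (height-cons-above ps (ℕₚ.n<1+n s)))
                   (cong (_≡ᵇ x) (sym (height-cons-below ps ℕₚ.≤-refl))))
            (heightsFrom-lower-away v (suc s) s ps (λ i s<i _ i≡s → ℕₚ.<-irrefl (sym i≡s) s<i))
heightsFrom-lower-at (x ∷ v) (Fin.suc j) s y ps y≡s+1+j 1≤vⱼ =
  cong₂ _∧_ (cong (_≡ᵇ x) (height-cons-cong s (suc y) y ps (<ᵇ-lower s y (λ s≡y → ℕₚ.<-irrefl s≡y s<y))))
            (heightsFrom-lower-at v j (suc s) y ps (trans y≡s+1+j (ℕₚ.+-suc s (toℕ j))) 1≤vⱼ)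
  where
  s<y : s < y
  s<y = subst (s <_) (sym y≡s+1+j) (subst (s <_) (sym (ℕₚ.+-suc s (toℕ j))) (s≤s (ℕₚ.m≤m+n s (toℕ j))))

heightsFrom-drop-one : ∀ {n} (v : Vec ℕ n) s ps → 1 ≤ s → heightsFrom s v (1 ∷ ps) ≡ heightsFrom s v ps
heightsFrom-drop-one v s ps 1≤s =
  heightsFrom-cong v s _ _ (λ i s≤i _ → height-cons-below ps (ℕₚ.≤-trans 1≤s s≤i))

firstOK-cons : ∀ z n a ps → z ℤ.+ + 2 ≡ + n → firstOK z (a ∷ ps) ≡ (n ≤ᵇ a)
firstOK-cons z n a ps z+2≡n rewrite z+2≡n = isYes≗does (+ n ℤ.≤? + a)

firstOK-accepts : ∀ z n a ps → z ℤ.+ + 2 ≡ + n → n ≤ a → firstOK z (a ∷ ps) ≡ true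
firstOK-accepts z n a ps z+2≡n n≤a = trans (firstOK-cons z n a ps z+2≡n) (true-if (ℕₚ.≤⇒≤ᵇ n≤a))

firstOK-rejects : ∀ z n a ps → z ℤ.+ + 2 ≡ + n → a < n → firstOK z (a ∷ ps) ≡ false
firstOK-rejects z n a ps z+2≡n a<n =
  trans (firstOK-cons z n a ps z+2≡n) (false-if (λ n≤a → ℕₚ.<⇒≱ a<n (ℕₚ.≤ᵇ⇒≤ n a n≤a)))

threshold : ∀ j → + j ℤ.+ + 2 ≡ + suc (suc j)
threshold j = cong +_ (ℕₚ.+-comm j 2)

threshold⁺ : ∀ j → (+ j ℤ.+ + 1) ℤ.+ + 2 ≡ + suc (suc (suc j))
threshold⁺ j = cong +_ (trans (ℕₚ.+-assoc j 1 2) (ℕₚ.+-comm j 3))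

threshold⁻ : ∀ j → (+ j ℤ.- + 1) ℤ.+ + 2 ≡ + suc j
threshold⁻ j = trans (shift (+ j)) (cong +_ (ℕₚ.+-comm j 1))
  where
  shift : ∀ x → (x ℤ.- + 1) ℤ.+ + 2 ≡ x ℤ.+ + 1
  shift = solve-∀

inI-wrongWeight : ∀ {r} z k l (h : Vec ℕ r) p → (weight p ≡ k → ⊥) → inI z k l h p ≡ false
inI-wrongWeight z k l h p w≢k rewrite false-if (λ w≡k → w≢k (ℕₚ.≡ᵇ⇒≡ (weight p) k w≡k)) = refl

inI-firstFails : ∀ {r} z k l (h : Vec ℕ r) p → firstOK z p ≡ false → inI z k l h p ≡ false
inI-firstFails z k l h p fails rewrite fails = conjunction-false (weight p ≡ᵇ k) (length p ≡ᵇ l) (heightsFrom 1 h p)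
  where
  conjunction-false : ∀ a b c → (a ∧ (b ∧ (c ∧ false))) ≡ false
  conjunction-false false b     c     = refl
  conjunction-false true  false c     = refl
  conjunction-false true  true  false = refl
  conjunction-false true  true  true  = refl

inI-lower : ∀ {r} z z′ k l (h h′ : Vec ℕ r) a ps →
  heightsFrom 1 h (suc a ∷ ps) ≡ heightsFrom 1 h′ (a ∷ ps) →
  firstOK z (suc a ∷ ps) ≡ firstOK z′ (a ∷ ps) →
  inI z (suc k) l h (suc a ∷ ps) ≡ inI z′ k l h′ (a ∷ ps)
inI-lower z z′ k l h h′ a ps heights≡ first≡ =
  cong₂ (λ x y → (weight (a ∷ ps) ≡ᵇ k) ∧ ((length (a ∷ ps) ≡ᵇ l) ∧ (x ∧ y))) heights≡ first≡

inI-dropOne : ∀ {r} z k l (h : Vec ℕ r) p → firstOK z (1 ∷ p) ≡ firstOK z p →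
  inI z (suc k) (suc l) h (1 ∷ p) ≡ inI z k l h p
inI-dropOne z k l h p first≡ =
  cong₂ (λ x y → (weight p ≡ᵇ k) ∧ ((length p ≡ᵇ l) ∧ (x ∧ y))) (heightsFrom-drop-one h 1 p ℕₚ.≤-refl) first≡

inI-firstOnly : ∀ {r} z z′ k l (h : Vec ℕ r) p → firstOK z p ≡ firstOK z′ p → inI z k l h p ≡ inI z′ k l h p
inI-firstOnly z z′ k l h p first≡ = cong (λ y → (weight p ≡ᵇ k) ∧ ((length p ≡ᵇ l) ∧ (heightsFrom 1 h p ∧ y))) first≡

summand : ∀ {r} → ℤ → ℕ → ℕ → Vec ℕ r → List ℕ → Ser
summand z k l h p = ite (inI z k l h p) (Lit p)

G-sumOver : ∀ {r} z k l (h : Vec ℕ r) → G z k l h ≋ sumOver l k (summand z k l h)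
G-sumOver z k l h = sumMap-filter Lit (inI z k l h) (lists l k)

G⊖G-sumOver : ∀ {r} z z′ k l (h h′ : Vec ℕ r) →
  (G z k l h ⊖ˢ G z′ k l h′) ≋ sumOver l k (λ p → summand z k l h p ⊖ˢ summand z′ k l h′ p)
G⊖G-sumOver z z′ k l h h′ =
  ≋-trans (⊖-cong (G-sumOver z k l h) (G-sumOver z′ k l h′))
          (≋-sym (sumMap-⊖ (summand z k l h) (summand z′ k l h′) (lists l k)))

G⊕G⊖G-sumOver : ∀ {r} z z′ z″ k l (h h′ h″ : Vec ℕ r) →
  ((G z k l h ⊕ˢ G z′ k l h′) ⊖ˢ G z″ k l h″)
    ≋ sumOver l k (λ p → (summand z k l h p ⊕ˢ summand z′ k l h′ p) ⊖ˢ summand z″ k l h″ p)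
G⊕G⊖G-sumOver z z′ z″ k l h h′ h″ =
  ≋-trans (⊖-cong (⊕-cong (G-sumOver z k l h) (G-sumOver z′ k l h′)) (G-sumOver z″ k l h″))
  (≋-trans (⊖-cong (≋-sym (sumMap-⊕ (summand z k l h) (summand z′ k l h′) (lists l k))) ≋-refl)
           (≋-sym (sumMap-⊖ (λ p → summand z k l h p ⊕ˢ summand z′ k l h′ p) (summand z″ k l h″) (lists l k))))

summand-bounded : ∀ {r} z k l (h : Vec ℕ r) p → k < weight p → summand z k l h p ≋ 0ˢ
summand-bounded z k l h p k<w = ite-condition (Lit p) (inI-wrongWeight z k l h p (λ w≡k → ℕₚ.<⇒≢ k<w (sym w≡k)))

summand-firstFails : ∀ {r} z k l (h : Vec ℕ r) p → firstOK z p ≡ false → summand z k l h p ≋ 0ˢ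
summand-firstFails z k l h p fails = ite-condition (Lit p) (inI-firstFails z k l h p fails)

summand-firstOne : ∀ {r} z n k l (h : Vec ℕ r) ps → z ℤ.+ + 2 ≡ + suc (suc n) → summand z k l h (1 ∷ ps) ≋ 0ˢ
summand-firstOne z n k l h ps z+2≡n+2 =
  summand-firstFails z k l h (1 ∷ ps) (firstOK-rejects z _ 1 ps z+2≡n+2 (s≤s (s≤s z≤n)))

zDq-ite-Lit : ∀ b a ps → zDq (ite b (Lit (suc a ∷ ps))) ≋ ite b (Lit (a ∷ ps))
zDq-ite-Lit b a ps = ≋-trans (L-ite zDq-linear b (Lit (suc a ∷ ps))) (ite-cong b (zDq-Lit a ps))

ite-⊖-cong : ∀ X {a b c d} → a ≡ c → b ≡ d → (ite a X ⊖ˢ ite b X) ≋ (ite c X ⊖ˢ ite d X)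
ite-⊖-cong X a≡c b≡d = ⊖-cong (ite-condition X a≡c) (ite-condition X b≡d)

ite-⊖-cancel : ∀ X {a b c d} → a ≡ b → c ≡ d → (ite a X ⊖ˢ ite b X) ≋ (ite c X ⊖ˢ ite d X)
ite-⊖-cancel X {a} {c = c} refl refl = ≋-trans (ite⊖ite a X) (≋-sym (ite⊖ite c X))

ite-split-right : ∀ X {p a b c} → p ≡ b → a ≡ c → ite p X ≋ ((ite a X ⊕ˢ ite b X) ⊖ˢ ite c X)
ite-split-right X {p} {a} refl refl N c x = add-sub-left (ite a X N c x) (ite p X N c x)
  where
  add-sub-left : ∀ u v → v ≡ (u ℤ.+ v) ℤ.- u
  add-sub-left = solve-∀

ite-split-left : ∀ X {p a b c} → p ≡ a → b ≡ c → ite p X ≋ ((ite a X ⊕ˢ ite b X) ⊖ˢ ite c X)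
ite-split-left X {p} {b = b} refl refl N c x = add-sub-right (ite p X N c x) (ite b X N c x)
  where
  add-sub-right : ∀ u v → u ≡ (u ℤ.+ v) ℤ.- v
  add-sub-right = solve-∀

-- With p = (a+2, ps), p′ = (a+1, ps) and h′ = h with h_r lowered:
--   [p ∈ I_{r-1}(k+1,l,h)] = [p′ ∈ I_{r-1}(k,l,h)] + [p′ ∈ I_{r-2}(k,l,h′)] - [p′ ∈ I_{r-1}(k,l,h′)].
-- For a < r-1 every term vanishes; for a = r-1 lowering k₁ = r+1 lowers the
-- r-height; for a > r-1 no height changes.
part-i-indicators : ∀ r′ (h : Vec ℕ (suc r′)) K′ l a ps X → 1 ≤ lookup h (fromℕ r′) →
  ite (inI (+ r′) (suc K′) l h (suc (suc a) ∷ ps)) X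
    ≋ ((ite (inI (+ r′) K′ l h (suc a ∷ ps)) X
        ⊕ˢ ite (inI (+ r′ ℤ.- + 1) K′ l (updateAt h (fromℕ r′) (_∸ 1)) (suc a ∷ ps)) X)
        ⊖ˢ ite (inI (+ r′) K′ l (updateAt h (fromℕ r′) (_∸ 1)) (suc a ∷ ps)) X)
part-i-indicators r′ h K′ l a ps X 1≤hᵣ with ℕₚ.<-cmp a r′
... | tri< a<r′ _ _ = ite-split-right X
  (trans (inI-firstFails z (suc K′) l h p (firstOK-rejects z _ _ ps (threshold r′) (s≤s (s≤s a<r′))))
         (sym (inI-firstFails z⁻ K′ l h′ p′ (firstOK-rejects z⁻ _ _ ps (threshold⁻ r′) (s≤s a<r′)))))
  (trans (inI-firstFails z K′ l h p′ (firstOK-rejects z _ _ ps (threshold r′) (s≤s (s≤s (ℕₚ.<⇒≤ a<r′)))))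
         (sym (inI-firstFails z K′ l h′ p′ (firstOK-rejects z _ _ ps (threshold r′) (s≤s (s≤s (ℕₚ.<⇒≤ a<r′)))))))
  where
  z = + r′ ; z⁻ = + r′ ℤ.- + 1 ; p = suc (suc a) ∷ ps ; p′ = suc a ∷ ps ; h′ = updateAt h (fromℕ r′) (_∸ 1)
... | tri≈ _ refl _ = ite-split-right X
  (inI-lower z z⁻ K′ l h h′ (suc a) ps
     (heightsFrom-lower-at h (fromℕ r′) 1 (suc r′) ps (cong suc (sym (toℕ-fromℕ r′))) 1≤hᵣ)
     (trans (firstOK-accepts z _ _ ps (threshold r′) ℕₚ.≤-refl)
            (sym (firstOK-accepts z⁻ _ _ ps (threshold⁻ r′) ℕₚ.≤-refl))))
  (trans (inI-firstFails z K′ l h p′ (firstOK-rejects z _ _ ps (threshold r′) ℕₚ.≤-refl))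
         (sym (inI-firstFails z K′ l h′ p′ (firstOK-rejects z _ _ ps (threshold r′) ℕₚ.≤-refl))))
  where
  z = + r′ ; z⁻ = + r′ ℤ.- + 1 ; p′ = suc a ∷ ps ; h′ = updateAt h (fromℕ r′) (_∸ 1)
... | tri> _ _ r′<a = ite-split-left X
  (inI-lower z z K′ l h h (suc a) ps
     (heightsFrom-lower-away h 1 (suc a) ps (λ i _ i<r+2 i≡a+1 →
        ℕₚ.<-irrefl i≡a+1 (ℕₚ.≤-trans i<r+2 (s≤s r′<a))))
     (trans (firstOK-accepts z _ _ ps (threshold r′) (s≤s (s≤s (ℕₚ.<⇒≤ r′<a))))
            (sym (firstOK-accepts z _ _ ps (threshold r′) (s≤s r′<a)))))
  (inI-firstOnly z⁻ z K′ l h′ p′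
     (trans (firstOK-accepts z⁻ _ _ ps (threshold⁻ r′) (s≤s (ℕₚ.<⇒≤ r′<a)))
            (sym (firstOK-accepts z _ _ ps (threshold r′) (s≤s r′<a)))))
  where
  z = + r′ ; z⁻ = + r′ ℤ.- + 1 ; p′ = suc a ∷ ps ; h′ = updateAt h (fromℕ r′) (_∸ 1)

part-i : ∀ r′ (h : Vec ℕ (suc r′)) k l → 1 ≤ l → l ≤ k → 1 ≤ lookup h (fromℕ r′) →
  zDq (G (+ r′) k l h)
    ≋ ((G (+ r′) (k ∸ 1) l h ⊕ˢ G (+ r′ ℤ.- + 1) (k ∸ 1) l (updateAt h (fromℕ r′) (_∸ 1)))
        ⊖ˢ G (+ r′) (k ∸ 1) l (updateAt h (fromℕ r′) (_∸ 1)))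
part-i r′ h zero     (suc l′) _ () _
part-i r′ h (suc K′) (suc l′) _ _ 1≤hᵣ =
  zDq (G z K l h)
    ≋⟨ zDq-linear .L-cong (G-sumOver z K l h) ⟩
  zDq (sumOver l K (summand z K l h))
    ≋⟨ zDq-sumOver-shift l′ K′ (summand z K l h) rhs (summand-bounded z K l h) lowering firstEntryOne ⟩
  sumOver l K′ rhs
    ≋⟨ ≋-sym (G⊕G⊖G-sumOver z z⁻ z K′ l h h′ h′) ⟩
  ((G z K′ l h ⊕ˢ G z⁻ K′ l h′) ⊖ˢ G z K′ l h′) ∎ˢ
  where
  z = + r′ ; z⁻ = + r′ ℤ.- + 1 ; K = suc K′ ; l = suc l′ ; h′ = updateAt h (fromℕ r′) (_∸ 1)
  rhs : List ℕ → Ser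
  rhs p = (summand z K′ l h p ⊕ˢ summand z⁻ K′ l h′ p) ⊖ˢ summand z K′ l h′ p
  lowering : ∀ a ps → zDq (summand z K l h (suc (suc a) ∷ ps)) ≋ rhs (suc a ∷ ps)
  lowering a ps = ≋-trans (zDq-ite-Lit (inI z K l h (suc (suc a) ∷ ps)) (suc a) ps)
                          (part-i-indicators r′ h K′ l a ps (Lit (suc a ∷ ps)) 1≤hᵣ)
  firstEntryOne : ∀ ps → zDq (summand z K l h (1 ∷ ps)) ≋ 0ˢ
  firstEntryOne ps = ≋-trans (zDq-linear .L-cong (summand-firstOne z r′ K l h ps (threshold r′))) (zDq-linear .L-0)

-- With p = (a+2, ps), p′ = (a+1, ps), h′ = h with h_{j+1} lowered:
--   [p ∈ I_j(k+1,l,h)] - [p ∈ I_{j+1}(k+1,l,h)] = [p′ ∈ I_{j-1}(k,l,h′)] - [p′ ∈ I_j(k,l,h′)].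
-- Both sides vanish unless a = j, where lowering k₁ = j+2 lowers the
-- (j+1)-height.
part-ii-indicators : ∀ {r} (h : Vec ℕ r) (j : Fin r) K′ l a ps X → 1 ≤ lookup h j →
  (ite (inI (+ toℕ j) (suc K′) l h (suc (suc a) ∷ ps)) X
     ⊖ˢ ite (inI (+ toℕ j ℤ.+ + 1) (suc K′) l h (suc (suc a) ∷ ps)) X)
    ≋ (ite (inI (+ toℕ j ℤ.- + 1) K′ l (updateAt h j (_∸ 1)) (suc a ∷ ps)) X
         ⊖ˢ ite (inI (+ toℕ j) K′ l (updateAt h j (_∸ 1)) (suc a ∷ ps)) X)
part-ii-indicators h j K′ l a ps X 1≤hⱼ with ℕₚ.<-cmp a (toℕ j)
... | tri< a<j _ _ = ite-⊖-cong X
  (trans (inI-firstFails z (suc K′) l h p (firstOK-rejects z _ _ ps (threshold (toℕ j)) (s≤s (s≤s a<j))))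
         (sym (inI-firstFails z⁻ K′ l h′ p′ (firstOK-rejects z⁻ _ _ ps (threshold⁻ (toℕ j)) (s≤s a<j)))))
  (trans (inI-firstFails z⁺ (suc K′) l h p
            (firstOK-rejects z⁺ _ _ ps (threshold⁺ (toℕ j)) (s≤s (s≤s (s≤s (ℕₚ.<⇒≤ a<j))))))
         (sym (inI-firstFails z K′ l h′ p′
            (firstOK-rejects z _ _ ps (threshold (toℕ j)) (s≤s (s≤s (ℕₚ.<⇒≤ a<j)))))))
  where
  z = + toℕ j ; z⁺ = + toℕ j ℤ.+ + 1 ; z⁻ = + toℕ j ℤ.- + 1
  p = suc (suc a) ∷ ps ; p′ = suc a ∷ ps ; h′ = updateAt h j (_∸ 1)
... | tri≈ _ refl _ = ite-⊖-cong X
  (inI-lower z z⁻ K′ l h h′ (suc a) ps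
     (heightsFrom-lower-at h j 1 (suc a) ps refl 1≤hⱼ)
     (trans (firstOK-accepts z _ _ ps (threshold a) ℕₚ.≤-refl)
            (sym (firstOK-accepts z⁻ _ _ ps (threshold⁻ a) ℕₚ.≤-refl))))
  (trans (inI-firstFails z⁺ (suc K′) l h p (firstOK-rejects z⁺ _ _ ps (threshold⁺ a) ℕₚ.≤-refl))
         (sym (inI-firstFails z K′ l h′ p′ (firstOK-rejects z _ _ ps (threshold a) ℕₚ.≤-refl))))
  where
  z = + a ; z⁺ = + a ℤ.+ + 1 ; z⁻ = + a ℤ.- + 1
  p = suc (suc a) ∷ ps ; p′ = suc a ∷ ps ; h′ = updateAt h j (_∸ 1)
... | tri> _ _ j<a = ite-⊖-cancel X
  (inI-firstOnly z z⁺ (suc K′) l h p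
     (trans (firstOK-accepts z _ _ ps (threshold (toℕ j)) (s≤s (s≤s (ℕₚ.<⇒≤ j<a))))
            (sym (firstOK-accepts z⁺ _ _ ps (threshold⁺ (toℕ j)) (s≤s (s≤s j<a))))))
  (inI-firstOnly z⁻ z K′ l h′ p′
     (trans (firstOK-accepts z⁻ _ _ ps (threshold⁻ (toℕ j)) (s≤s (ℕₚ.<⇒≤ j<a)))
            (sym (firstOK-accepts z _ _ ps (threshold (toℕ j)) (s≤s j<a)))))
  where
  z = + toℕ j ; z⁺ = + toℕ j ℤ.+ + 1 ; z⁻ = + toℕ j ℤ.- + 1
  p = suc (suc a) ∷ ps ; p′ = suc a ∷ ps ; h′ = updateAt h j (_∸ 1)

part-ii : ∀ {r} (h : Vec ℕ r) (j : Fin r) k l → 1 ≤ l → l ≤ k → 1 ≤ lookup h j →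
  zDq (G (+ toℕ j) k l h ⊖ˢ G (+ toℕ j ℤ.+ + 1) k l h)
    ≋ (G (+ toℕ j ℤ.- + 1) (k ∸ 1) l (updateAt h j (_∸ 1)) ⊖ˢ G (+ toℕ j) (k ∸ 1) l (updateAt h j (_∸ 1)))
part-ii h j zero     (suc l′) _ () _
part-ii h j (suc K′) (suc l′) _ _ 1≤hⱼ =
  zDq (G z K l h ⊖ˢ G z⁺ K l h)
    ≋⟨ zDq-linear .L-cong (G⊖G-sumOver z z⁺ K l h h) ⟩
  zDq (sumOver l K lhs)
    ≋⟨ zDq-sumOver-shift l′ K′ lhs rhs bounded lowering firstEntryOne ⟩
  sumOver l K′ rhs
    ≋⟨ ≋-sym (G⊖G-sumOver z⁻ z K′ l h′ h′) ⟩
  (G z⁻ K′ l h′ ⊖ˢ G z K′ l h′) ∎ˢ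
  where
  z = + toℕ j ; z⁺ = + toℕ j ℤ.+ + 1 ; z⁻ = + toℕ j ℤ.- + 1
  K = suc K′ ; l = suc l′ ; h′ = updateAt h j (_∸ 1)
  lhs rhs : List ℕ → Ser
  lhs p = summand z K l h p ⊖ˢ summand z⁺ K l h p
  rhs p = summand z⁻ K′ l h′ p ⊖ˢ summand z K′ l h′ p
  bounded : ∀ p → K < weight p → lhs p ≋ 0ˢ
  bounded p K<w = ≋-trans (⊖-cong (summand-bounded z K l h p K<w) (summand-bounded z⁺ K l h p K<w))
                          (ite⊖ite false (Lit p))
  lowering : ∀ a ps → zDq (lhs (suc (suc a) ∷ ps)) ≋ rhs (suc a ∷ ps)
  lowering a ps =
    ≋-trans (L-⊖ zDq-linear (summand z K l h p) (summand z⁺ K l h p))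
    (≋-trans (⊖-cong (zDq-ite-Lit (inI z K l h p) (suc a) ps) (zDq-ite-Lit (inI z⁺ K l h p) (suc a) ps))
             (part-ii-indicators h j K′ l a ps (Lit (suc a ∷ ps)) 1≤hⱼ))
    where p = suc (suc a) ∷ ps
  firstEntryOne : ∀ ps → zDq (lhs (1 ∷ ps)) ≋ 0ˢ
  firstEntryOne ps =
    ≋-trans (zDq-linear .L-cong (≋-trans (⊖-cong (summand-firstOne z (toℕ j) K l h ps (threshold (toℕ j)))
                                                 (summand-firstOne z⁺ (suc (toℕ j)) K l h ps (threshold⁺ (toℕ j))))
                                         (ite⊖ite false (Lit (1 ∷ ps)))))
            (zDq-linear .L-0)

-- Part (iii).  G^t - G^t_0 collects the indices with k₁ = 1; z D_q turns
-- Li^t_{(1,p)} into Li^t_{(0,p)} = (t + z/(1-z)) Li^t_p, and (1,p) ∈ I(k,l,h)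
-- iff p ∈ I(k-1,l-1,h).

ite-t+zOver1-z : ∀ b x → ite b (tˢ x ⊕ˢ zOver1-z x) ≋ (tˢ (ite b x) ⊕ˢ zOver1-z (ite b x))
ite-t+zOver1-z true  x = ≋-refl
ite-t+zOver1-z false x = ≋-sym (⊕-cong (t-linear .L-0) (zOver1-z-linear .L-0))

G-G₀-summand-cancels : ∀ {r} k l (h : Vec ℕ r) i ps →
  (summand -[1+ 0 ] k l h (suc (suc i) ∷ ps) ⊖ˢ summand (+ 0) k l h (suc (suc i) ∷ ps)) ≋ 0ˢ
G-G₀-summand-cancels k l h i ps = ≋-trans
  (ite-⊖-cancel (Lit p)
    (inI-firstOnly -[1+ 0 ] (+ 0) k l h p
      (trans (firstOK-accepts -[1+ 0 ] 1 (suc (suc i)) ps refl (s≤s z≤n))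
             (sym (firstOK-accepts (+ 0) 2 (suc (suc i)) ps refl (s≤s (s≤s z≤n))))))
    (refl {x = false}))
  (ite⊖ite false (Lit p))
  where p = suc (suc i) ∷ ps

summand-lowered-one : ∀ {r} k l (h : Vec ℕ r) i bs →
  ite (inI -[1+ 0 ] (suc k) (suc l) h (1 ∷ suc i ∷ bs)) (Lit (0 ∷ suc i ∷ bs))
    ≋ (tˢ (summand -[1+ 0 ] k l h (suc i ∷ bs)) ⊕ˢ zOver1-z (summand -[1+ 0 ] k l h (suc i ∷ bs)))
summand-lowered-one k l h i bs =
  ≋-trans (ite-cong (inI z (suc k) (suc l) h (1 ∷ p)) (Lit-zero-head (suc i) bs))
  (≋-trans (ite-condition (tˢ (Lit p) ⊕ˢ zOver1-z (Lit p))
             (inI-dropOne z k l h p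
               (trans (firstOK-accepts z 1 1 p refl ℕₚ.≤-refl) (sym (firstOK-accepts z 1 (suc i) bs refl (s≤s z≤n))))))
           (ite-t+zOver1-z (inI z k l h p) (Lit p)))
  where
  z = -[1+ 0 ]
  p = suc i ∷ bs

part-iii : ∀ {r} (h : Vec ℕ r) k l → 2 ≤ l → l ≤ k →
  zDq (G -[1+ 0 ] k l h ⊖ˢ G (+ 0) k l h)
    ≋ (tˢ (G -[1+ 0 ] (k ∸ 1) (l ∸ 1) h) ⊕ˢ zOver1-z (G -[1+ 0 ] (k ∸ 1) (l ∸ 1) h))
part-iii h k        (suc zero)     (s≤s ()) _
part-iii h zero     (suc (suc l″)) _ ()
part-iii h (suc K′) (suc (suc l″)) _ _ =
  zDq (G z K l h ⊖ˢ G z₀ K l h)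
    ≋⟨ zDq-linear .L-cong (≋-trans (G⊖G-sumOver z z₀ K l h h)
                                   (sumOver-firstEntryOne l₁ K′ lhs (G-G₀-summand-cancels K l h))) ⟩
  zDq (sumOver l₁ K (λ ps → lhs (1 ∷ ps)))
    ≋⟨ L-sumSer zDq-linear (λ ps → lhs (1 ∷ ps)) (lists l₁ K) ⟩
  sumOver l₁ K (λ ps → zDq (lhs (1 ∷ ps)))
    ≋⟨ sumOver-cong l₁ K zDq-lhs ⟩
  sumOver l₁ K lowered
    ≋⟨ sumOver-truncate l₁ K K′ lowered (ℕₚ.n≤1+n K′)
         (λ ps K′<w → ite-condition (Lit (0 ∷ ps))
                        (inI-wrongWeight z K l h (1 ∷ ps) (λ w≡K → ℕₚ.<⇒≢ (s≤s K′<w) (sym w≡K)))) ⟩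
  sumOver l₁ K′ lowered
    ≋⟨ sumOver-cong-cons l″ K′ (summand-lowered-one K′ l₁ h) ⟩
  sumOver l₁ K′ (λ p → tˢ (summand z K′ l₁ h p) ⊕ˢ zOver1-z (summand z K′ l₁ h p))
    ≋⟨ ≋-trans (sumMap-⊕ (tˢ ∘ summand z K′ l₁ h) (zOver1-z ∘ summand z K′ l₁ h) (lists l₁ K′))
               (⊕-cong (≋-sym (L-sumSer t-linear (summand z K′ l₁ h) (lists l₁ K′)))
                       (≋-sym (L-sumSer zOver1-z-linear (summand z K′ l₁ h) (lists l₁ K′)))) ⟩
  (tˢ (sumOver l₁ K′ (summand z K′ l₁ h)) ⊕ˢ zOver1-z (sumOver l₁ K′ (summand z K′ l₁ h)))
    ≋⟨ ≋-sym (⊕-cong (t-linear .L-cong (G-sumOver z K′ l₁ h))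
                     (zOver1-z-linear .L-cong (G-sumOver z K′ l₁ h))) ⟩
  (tˢ (G z K′ l₁ h) ⊕ˢ zOver1-z (G z K′ l₁ h)) ∎ˢ
  where
  z = -[1+ 0 ] ; z₀ = + 0 ; K = suc K′ ; l₁ = suc l″ ; l = suc l₁
  lhs lowered : List ℕ → Ser
  lhs p = summand z K l h p ⊖ˢ summand z₀ K l h p
  lowered ps = ite (inI z K l h (1 ∷ ps)) (Lit (0 ∷ ps))
  zDq-lhs : ∀ ps → zDq (lhs (1 ∷ ps)) ≋ lowered ps
  zDq-lhs ps = ≋-trans
    (zDq-linear .L-cong {g = ite (inI z K l h (1 ∷ ps)) (Lit (1 ∷ ps))}
      (≋-trans (⊖-cong (≋-refl {summand z K l h (1 ∷ ps)}) (summand-firstOne z₀ 0 K l h ps refl))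
               (λ N c b → ℤₚ.+-identityʳ _)))
    (zDq-ite-Lit (inI z K l h (1 ∷ ps)) 0 ps)

depth≤weight : ∀ {r} k l (h : Vec ℕ r) → l + sum h ≤ k → l ≤ k
depth≤weight k l h l+Σh≤k = ℕₚ.≤-trans (ℕₚ.m≤m+n l (sum h)) l+Σh≤k

lookup≤head : ∀ {r} (h : Vec ℕ (suc r)) → Decreasing h → ∀ j → lookup h j ≤ head h
lookup≤head (x ∷ [])     dec Fin.zero    = ℕₚ.≤-refl
lookup≤head (x ∷ y ∷ ys) dec Fin.zero    = ℕₚ.≤-refl
lookup≤head (x ∷ y ∷ ys) dec (Fin.suc j) =
  ℕₚ.≤-trans (lookup≤head (y ∷ ys) (λ i → dec (Fin.suc i)) j) (dec Fin.zero)

positive-depth : ∀ {r} l (h : Vec ℕ (suc r)) j → head h ≤ l → Decreasing h → 1 ≤ lookup h j → 1 ≤ l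
positive-depth l h j h₁≤l dec 1≤hⱼ = ℕₚ.≤-trans 1≤hⱼ (ℕₚ.≤-trans (lookup≤head h dec j) h₁≤l)

last≡lookup : ∀ {r} (h : Vec ℕ (suc r)) → last h ≡ lookup h (fromℕ r)
last≡lookup (x ∷ [])     = refl
last≡lookup (x ∷ y ∷ ys) = last≡lookup (y ∷ ys)

lemma3p2 : (r′ : ℕ) →
    ((k l : ℕ) (h : Vec ℕ (suc r′)) →
      l + sum h ≤ k → head h ≤ l → Decreasing h → 1 ≤ last h →
      zDq (G (+ r′) k l h)
        ≋ ((G (+ r′) (k ∸ 1) l h
             ⊕ˢ G (+ r′ ℤ.- + 1) (k ∸ 1) l (updateAt h (fromℕ r′) (_∸ 1)))
             ⊖ˢ G (+ r′) (k ∸ 1) l (updateAt h (fromℕ r′) (_∸ 1))))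
    ×
    ((j : Fin (suc r′)) (k l : ℕ) (h : Vec ℕ (suc r′)) →
      2 + toℕ j ≤ suc r′ →
      l + sum h ≤ k → head h ≤ l → Decreasing h → 1 ≤ lookup h j →
      zDq (G (+ toℕ j) k l h ⊖ˢ G (+ toℕ j ℤ.+ + 1) k l h)
        ≋ (G (+ toℕ j ℤ.- + 1) (k ∸ 1) l (updateAt h j (_∸ 1))
             ⊖ˢ G (+ toℕ j) (k ∸ 1) l (updateAt h j (_∸ 1))))
    ×
    ((k l : ℕ) (h : Vec ℕ (suc r′)) →
      l + sum h ≤ k → head h ≤ l → Decreasing h → 2 ≤ l →
      zDq (G -[1+ 0 ] k l h ⊖ˢ G (+ 0) k l h)
        ≋ (tˢ (G -[1+ 0 ] (k ∸ 1) (l ∸ 1) h)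
             ⊕ˢ zOver1-z (G -[1+ 0 ] (k ∸ 1) (l ∸ 1) h)))
lemma3p2 r′ =
    (λ k l h l+Σh≤k h₁≤l dec 1≤hᵣ →
       let 1≤hᵣ′ = subst (1 ≤_) (last≡lookup h) 1≤hᵣ in
       part-i r′ h k l (positive-depth l h (fromℕ r′) h₁≤l dec 1≤hᵣ′) (depth≤weight k l h l+Σh≤k) 1≤hᵣ′)
  , (λ j k l h _ l+Σh≤k h₁≤l dec 1≤hⱼ →
       part-ii h j k l (positive-depth l h j h₁≤l dec 1≤hⱼ) (depth≤weight k l h l+Σh≤k) 1≤hⱼ)
  , (λ k l h l+Σh≤k _ _ 2≤l → part-iii h k l 2≤l (depth≤weight k l h l+Σh≤k))
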